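{- Let $m_1,m_2$ be positive integers and let $A=\{(z_1,w_1),\dots,(z_k,w_k)\}$ ($k\ge0$) be an antichain in $[m_1]\times[m_2]$ with $z_1<\dots<z_k$. Then $A$ is a maximal antichain if and only if its associated $(h,v,d)$-word contains no occurrence of the two consecutive letters $vh$.
   Context: $[m]=\{1,\dots,m\}$. On $[m_1]\times[m_2]$, $(x,y)>^*(z,w)$ iff $x\ge z$, $y\ge w$ and at least one inequality is strict. An antichain is a subset whose distinct elements are pairwise $>^*$-incomparable (so for $z_1<\dots<z_k$ one has $w_1>\dots>w_k$); it is maximal if not properly contained in another antichain. The associated $(h,v,d)$-word describes the grid line going from the NE corner to the SW corner of the $m_1\times m_2$ grid (rows $1..m_1$ top to bottom, columns $1..m_2$ left to right) separating the cells that belong to $A$ or $>^*$-dominate an element of $A$ from the other cells, where $v$ is a downward unit move, $h$ a leftward unit move and $d$ an anti-diagonal move through a cell of $A$. Explicitly, with $z_0=0$, $w_0=m_2+1$, the word is $v^{z_1-z_0-1}h^{w_0-w_1-1}\,d\,v^{z_2-z_1-1}h^{w_1-w_2-1}\,d\cdots d\,v^{z_k-z_{k-1}-1}h^{w_{k-1}-w_k-1}\,d\,v^{m_1-z_k}h^{w_k-1}$ (for $k=0$ it is $v^{m_1}h^{m_2}$), where $a^n$ denotes $n$ repetitions of the letter $a$. -}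

module Defs where

open import Data.Nat using (ℕ; zero; suc; _+_; _∸_; _≤_; _<_; _>_)
open import Data.Product using (_×_; _,_; Σ; ∃; ∃-syntax; proj₁; proj₂)
open import Data.Sum using (_⊎_)
open import Data.List using (List; []; _∷_; _++_; replicate)
open import Data.List.Membership.Propositional using (_∈_; _∉_)
open import Data.List.Relation.Unary.All using (All)
open import Data.List.Relation.Unary.Linked using (Linked)
open import Relation.Binary.PropositionalEquality using (_≡_)
open import Relation.Nullary using (¬_)

Point : Set
Point = ℕ × ℕ

InGrid : ℕ → ℕ → Point → Set
InGrid m₁ m₂ (z , w) = (1 ≤ z × z ≤ m₁) × (1 ≤ w × w ≤ m₂)

_>*_ : Point → Point → Set
(x , y) >* (z , w) = (z ≤ x × w ≤ y) × (z < x ⊎ w < y)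

Incomparable : Point → Point → Set
Incomparable p q = ¬ (p >* q) × ¬ (q >* p)

IsAntichain : ℕ → ℕ → List Point → Set
IsAntichain m₁ m₂ S =
  (∀ {p} → p ∈ S → InGrid m₁ m₂ p) ×
  (∀ {p q} → p ∈ S → q ∈ S → ¬ (p ≡ q) → Incomparable p q)

IsMaximalAntichain : ℕ → ℕ → List Point → Set
IsMaximalAntichain m₁ m₂ A =
  IsAntichain m₁ m₂ A ×
  (∀ (B : List Point) → IsAntichain m₁ m₂ B →
     (∀ {p} → p ∈ A → p ∈ B) → ∀ {q} → q ∈ B → q ∈ A)

ZIncreasing : List Point → Set
ZIncreasing = Linked (λ p q → proj₁ p < proj₁ q)

data Letter : Set where
  h v d : Letter

wordFrom : ℕ → ℕ → ℕ → List Point → List Letter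
wordFrom m₁ z' w' [] = replicate (m₁ ∸ z') v ++ replicate (w' ∸ 1) h
wordFrom m₁ z' w' ((z , w) ∷ rest) =
  replicate (z ∸ z' ∸ 1) v ++ replicate (w' ∸ w ∸ 1) h ++ (d ∷ wordFrom m₁ z w rest)

hvdWord : ℕ → ℕ → List Point → List Letter
hvdWord m₁ m₂ A = wordFrom m₁ 0 (suc m₂) A

ContainsVH : List Letter → Set
ContainsVH ws = ∃[ pre ] ∃[ post ] ws ≡ pre ++ (v ∷ h ∷ post)

-- The word is a concatenation of runs v^a h^b separated by d's, so it contains vh exactly when
-- some run has a, b ≥ 1.  Between consecutive corners (z', w') and (z, w) of the staircase,
-- with sentinels (0, m₂ + 1) in front and (m₁ + 1, 0) at the end, the run has a = z − z' − 1 and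
-- b = w' − w − 1; so a, b ≥ 1 says that the cell (z' + 1, w' − 1) lies in the grid strictly
-- between the two corners, hence is incomparable with every element of A and extends A.
-- Conversely, a cell outside A that is incomparable with all of A lies strictly between two
-- consecutive corners, and the run between them contains vh.
module Submission where

open import Defs
open import Data.Empty using (⊥-elim)
open import Data.List using (List; []; _∷_; _++_; replicate)
open import Data.List.Properties using (++-identityʳ)
open import Data.List.Membership.Propositional using (_∈_; _∉_)
open import Data.List.Relation.Unary.All as All using (All; []; _∷_; lookup; tabulate)
open import Data.List.Relation.Unary.AllPairs using (AllPairs; _∷_)
open import Data.List.Relation.Unary.Any using (here; there)
open import Data.List.Relation.Unary.Linked using (Linked; []; [-]; _∷_)
open import Data.List.Relation.Unary.Linked.Properties using (Linked⇒AllPairs)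
open import Data.Nat using (ℕ; zero; suc; _≤_; _<_; _∸_; _<?_; z≤n; s≤s; z<s)
open import Data.Nat.Properties
  using (_≟_; ≤-refl; ≤-trans; <-trans; <-irrefl; <-≤-trans; ≤-<-trans; <⇒≤; ≮⇒≥; m≤n⇒m≤1+n;
         <-cmp; n>0⇒n≢0; m∸n≢0⇒n<m; m<n⇒0<n∸m; ∸-+-assoc; +-comm)
open import Data.Product using (_×_; _,_; ∃-syntax; swap)
open import Data.Product.Properties using (≡-dec)
open import Data.Sum using (_⊎_; inj₁; inj₂; map₁)
open import Function using (_∘_)
open import Function.Bundles using (_⇔_; mk⇔; Equivalence)
open import Function.Properties.Equivalence using () renaming (trans to ⇔-trans; sym to ⇔-sym)
open import Function.Related.TypeIsomorphisms using (¬-cong-⇔)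
open import Relation.Binary.Definitions using (tri<; tri≈; tri>)
open import Relation.Binary.PropositionalEquality using (_≡_; _≢_; refl; cong; subst; sym; trans)
open import Relation.Nullary using (¬_; yes; no)
open import Data.List.Membership.DecPropositional (≡-dec _≟_ _≟_) using (_∈?_)

open Equivalence using (to; from)

private
  variable
    m₁ m₂ z' w' : ℕ
    A : List Point
    p q r : Point

data HasVH : List Letter → Set where
  here  : ∀ {ws} → HasVH (v ∷ h ∷ ws)
  there : ∀ {x ws} → HasVH ws → HasVH (x ∷ ws)

containsVH⇒hasVH : ∀ {ws} → ContainsVH ws → HasVH ws
containsVH⇒hasVH ([] , _ , refl) = here
containsVH⇒hasVH (x ∷ pre , post , refl) = there (containsVH⇒hasVH (pre , post , refl))

hasVH⇒containsVH : ∀ {ws} → HasVH ws → ContainsVH ws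
hasVH⇒containsVH (here {ws}) = [] , ws , refl
hasVH⇒containsVH (there {x} p) with hasVH⇒containsVH p
... | pre , post , refl = x ∷ pre , post , refl

hasVH-++⁺ʳ : ∀ xs {ws} → HasVH ws → HasVH (xs ++ ws)
hasVH-++⁺ʳ []       p = p
hasVH-++⁺ʳ (x ∷ xs) p = there (hasVH-++⁺ʳ xs p)

hasVH-hⁿ⁻ : ∀ b {ws} → HasVH (replicate b h ++ ws) → HasVH ws
hasVH-hⁿ⁻ zero    p         = p
hasVH-hⁿ⁻ (suc b) (there p) = hasVH-hⁿ⁻ b p

hasVH-vᵃhᵇ⁺ : ∀ {a b} ws → 0 < a → 0 < b → HasVH (replicate a v ++ replicate b h ++ ws)
hasVH-vᵃhᵇ⁺ {suc zero}    {suc b} ws _ _   = here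
hasVH-vᵃhᵇ⁺ {suc (suc a)} {b}     ws _ 0<b = there (hasVH-vᵃhᵇ⁺ {suc a} {b} ws z<s 0<b)

hasVH-vᵃhᵇ⁻ : ∀ a b {ws} → (∀ {ws'} → ws ≢ h ∷ ws') →
  HasVH (replicate a v ++ replicate b h ++ ws) → (0 < a × 0 < b) ⊎ HasVH ws
hasVH-vᵃhᵇ⁻ zero       b       _     p         = inj₂ (hasVH-hⁿ⁻ b p)
hasVH-vᵃhᵇ⁻ (suc zero) zero    ws≢h∷ here      = ⊥-elim (ws≢h∷ refl)
hasVH-vᵃhᵇ⁻ (suc zero) (suc b) _     here      = inj₁ (z<s , z<s)
hasVH-vᵃhᵇ⁻ (suc a)    b       ws≢h∷ (there p) = map₁ (λ (_ , 0<b) → z<s , 0<b) (hasVH-vᵃhᵇ⁻ a b ws≢h∷ p)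

0<m∸n⇔n<m : ∀ {m n} → 0 < m ∸ n ⇔ n < m
0<m∸n⇔n<m = mk⇔ (m∸n≢0⇒n<m ∘ n>0⇒n≢0) m<n⇒0<n∸m

0<m∸n∸1⇔1+n<m : ∀ {m n} → 0 < m ∸ n ∸ 1 ⇔ suc n < m
0<m∸n∸1⇔1+n<m {m} {n} = subst (λ k → 0 < k ⇔ suc n < m) m∸1+n≡m∸n∸1 0<m∸n⇔n<m
  where
  m∸1+n≡m∸n∸1 : m ∸ suc n ≡ m ∸ n ∸ 1
  m∸1+n≡m∸n∸1 = sym (trans (∸-+-assoc m n 1) (cong (m ∸_) (+-comm n 1)))

-- Gap m₁ z' w' A: some run v^a h^b of wordFrom m₁ z' w' A has a ≥ 1 and b ≥ 1.
data Gap (m₁ : ℕ) : ℕ → ℕ → List Point → Set where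
  gap-last  : z' < m₁ → 1 < w' → Gap m₁ z' w' []
  gap-here  : ∀ {z w} → suc z' < z → suc w < w' → Gap m₁ z' w' ((z , w) ∷ A)
  gap-there : ∀ {z w} → Gap m₁ z w A → Gap m₁ z' w' ((z , w) ∷ A)

gap⇒hasVH : Gap m₁ z' w' A → HasVH (wordFrom m₁ z' w' A)
gap⇒hasVH {m₁} {z'} {w'} (gap-last z'<m₁ 1<w') =
  subst HasVH (cong (replicate (m₁ ∸ z') v ++_) (++-identityʳ _))
    (hasVH-vᵃhᵇ⁺ [] (from 0<m∸n⇔n<m z'<m₁) (from 0<m∸n⇔n<m 1<w'))
gap⇒hasVH (gap-here 1+z'<z 1+w<w') = hasVH-vᵃhᵇ⁺ _ (from 0<m∸n∸1⇔1+n<m 1+z'<z) (from 0<m∸n∸1⇔1+n<m 1+w<w')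
gap⇒hasVH {z' = z'} {w'} (gap-there {z = z} {w = w} g) =
  hasVH-++⁺ʳ (replicate (z ∸ z' ∸ 1) v) (hasVH-++⁺ʳ (replicate (w' ∸ w ∸ 1) h) (there (gap⇒hasVH g)))

hasVH⇒gap : ∀ m₁ z' w' A → HasVH (wordFrom m₁ z' w' A) → Gap m₁ z' w' A
hasVH⇒gap m₁ z' w' [] p
  with hasVH-vᵃhᵇ⁻ (m₁ ∸ z') (w' ∸ 1) (λ ())
         (subst HasVH (cong (replicate (m₁ ∸ z') v ++_) (sym (++-identityʳ _))) p)
... | inj₁ (0<a , 0<b) = gap-last (to 0<m∸n⇔n<m 0<a) (to 0<m∸n⇔n<m 0<b)
hasVH⇒gap m₁ z' w' ((z , w) ∷ A) p with hasVH-vᵃhᵇ⁻ (z ∸ z' ∸ 1) (w' ∸ w ∸ 1) (λ ()) p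
... | inj₁ (0<a , 0<b) = gap-here (to 0<m∸n∸1⇔1+n<m 0<a) (to 0<m∸n∸1⇔1+n<m 0<b)
... | inj₂ p'          = gap-there (hasVH⇒gap m₁ z w A (there⁻¹ p'))
  where
  there⁻¹ : ∀ {ws} → HasVH (d ∷ ws) → HasVH ws
  there⁻¹ (there p) = p

infix 4 _↙_

_↙_ : Point → Point → Set
(z , w) ↙ (z' , w') = z < z' × w' < w

↙-trans : p ↙ q → q ↙ r → p ↙ r
↙-trans (z<z' , w'<w) (z'<z″ , w″<w') = <-trans z<z' z'<z″ , <-trans w″<w' w'<w

Separated : Point → Point → Set
Separated p q = p ↙ q ⊎ q ↙ p

separated-irrefl : ¬ Separated p p
separated-irrefl (inj₁ (z<z , _)) = <-irrefl refl z<z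
separated-irrefl (inj₂ (z<z , _)) = <-irrefl refl z<z

↙⇒¬>* : p ↙ q → ¬ (p >* q)
↙⇒¬>* (z<z' , _) ((z'≤z , _) , _) = <-irrefl refl (≤-<-trans z'≤z z<z')

↙⇒¬<* : p ↙ q → ¬ (q >* p)
↙⇒¬<* (_ , w'<w) ((_ , w≤w') , _) = <-irrefl refl (≤-<-trans w≤w' w'<w)

separated⇒incomparable : Separated p q → Incomparable p q
separated⇒incomparable (inj₁ p↙q) = ↙⇒¬>* p↙q , ↙⇒¬<* p↙q
separated⇒incomparable (inj₂ q↙p) = ↙⇒¬<* q↙p , ↙⇒¬>* q↙p

incomparable⇒separated : Incomparable p q → p ≢ q → Separated p q
incomparable⇒separated {z , w} {z' , w'} (p≯q , q≯p) p≢q with <-cmp z z'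
... | tri< z<z' _ _ with w' <? w
...   | yes w'<w = inj₁ (z<z' , w'<w)
...   | no  w'≮w = ⊥-elim (q≯p ((<⇒≤ z<z' , ≮⇒≥ w'≮w) , inj₁ z<z'))
incomparable⇒separated {z , w} {z' , w'} (p≯q , q≯p) p≢q | tri> _ _ z'<z with w <? w'
...   | yes w<w' = inj₂ (z'<z , w<w')
...   | no  w≮w' = ⊥-elim (p≯q ((<⇒≤ z'<z , ≮⇒≥ w≮w') , inj₁ z'<z))
incomparable⇒separated {z , w} {z , w'} (p≯q , q≯p) p≢q | tri≈ _ refl _ with <-cmp w w'
... | tri< w<w' _ _ = ⊥-elim (q≯p ((≤-refl , <⇒≤ w<w') , inj₂ w<w'))
... | tri≈ _ refl _ = ⊥-elim (p≢q refl)
... | tri> _ _ w'<w = ⊥-elim (p≯q ((≤-refl , <⇒≤ w'<w) , inj₂ w'<w))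

PairwiseIncomparable : List Point → Set
PairwiseIncomparable A = ∀ {p q} → p ∈ A → q ∈ A → p ≢ q → Incomparable p q

zIncreasing⇒↙-linked : PairwiseIncomparable A → ZIncreasing A → Linked _↙_ A
zIncreasing⇒↙-linked             _   []                     = []
zIncreasing⇒↙-linked             _   [-]                    = [-]
zIncreasing⇒↙-linked {p ∷ q ∷ A} inc (z<z' ∷ sorted) =
  p↙q ∷ zIncreasing⇒↙-linked (λ p∈ q∈ → inc (there p∈) (there q∈)) sorted
  where
  p≢q : p ≢ q
  p≢q refl = <-irrefl refl z<z'

  p↙q : p ↙ q
  p↙q with incomparable⇒separated (inc (here refl) (there (here refl)) p≢q) p≢q
  ... | inj₁ p↙q         = p↙q
  ... | inj₂ (z'<z , _) = ⊥-elim (<-irrefl refl (<-trans z<z' z'<z))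

corner-↙-linked : (∀ {p} → p ∈ A → InGrid m₁ m₂ p) → Linked _↙_ A → Linked _↙_ ((0 , suc m₂) ∷ A)
corner-↙-linked {A = []}    _      _ = [-]
corner-↙-linked {A = _ ∷ _} inGrid l with inGrid (here refl)
... | (1≤z , _) , (_ , w≤m₂) = (1≤z , s≤s w≤m₂) ∷ l

FreeCell : ℕ → ℕ → List Point → Set
FreeCell m₁ m₂ A = ∃[ q ] InGrid m₁ m₂ q × All (Separated q) A

gap⇒freeCell : Gap m₁ z' w' A → AllPairs _↙_ ((z' , w') ∷ A) → All (InGrid m₁ m₂) A → w' ≤ suc m₂ →
  ∃[ q ] InGrid m₁ m₂ q × (z' , w') ↙ q × All (Separated q) A
gap⇒freeCell {z' = z'} {w' = suc w'} (gap-last z'<m₁ (s≤s 1≤w')) _ _ (s≤s w'≤m₂) =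
  (suc z' , w') , ((z<s , z'<m₁) , (1≤w' , w'≤m₂)) , (≤-refl , ≤-refl) , []
gap⇒freeCell {z' = z'} {w' = suc w'} (gap-here {z = z} {w = w} 1+z'<z (s≤s 1+w≤w')) (_ ∷ (z,w↙A ∷ _))
             (((_ , z≤m₁) , _) ∷ _) (s≤s w'≤m₂) =
  (suc z' , w') , ((z<s , <⇒≤ (<-≤-trans 1+z'<z z≤m₁)) , (≤-trans (s≤s z≤n) 1+w≤w' , w'≤m₂)) ,
  (≤-refl , ≤-refl) , inj₁ q↙z,w ∷ All.map (inj₁ ∘ ↙-trans q↙z,w) z,w↙A
  where
  q↙z,w : (suc z' , w') ↙ (z , w)
  q↙z,w = 1+z'<z , 1+w≤w'
gap⇒freeCell (gap-there g) ((z',w'↙z,w ∷ _) ∷ ↙A) ((_ , (_ , w≤m₂)) ∷ inGrid) _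
  with gap⇒freeCell g ↙A inGrid (m≤n⇒m≤1+n w≤m₂)
... | q , q∈grid , z,w↙q , sep = q , q∈grid , ↙-trans z',w'↙z,w z,w↙q , inj₂ z,w↙q ∷ sep

freeCell⇒gap : InGrid m₁ m₂ q → (z' , w') ↙ q → All (Separated q) A → Gap m₁ z' w' A
freeCell⇒gap ((_ , q₁≤m₁) , (1≤q₂ , _)) (z'<q₁ , q₂<w') [] =
  gap-last (<-≤-trans z'<q₁ q₁≤m₁) (≤-<-trans 1≤q₂ q₂<w')
freeCell⇒gap _ (z'<q₁ , q₂<w') (inj₁ (q₁<z , w<q₂) ∷ _) = gap-here (≤-<-trans z'<q₁ q₁<z) (≤-<-trans w<q₂ q₂<w')
freeCell⇒gap q∈grid _ (inj₂ z,w↙q ∷ sep) = gap-there (freeCell⇒gap q∈grid z,w↙q sep)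

antichain-∷ : IsAntichain m₁ m₂ A → InGrid m₁ m₂ q → All (Separated q) A → IsAntichain m₁ m₂ (q ∷ A)
antichain-∷ {m₁} {m₂} {A} {q} (inGrid , inc) q∈grid sep = inGrid′ , inc′
  where
  inGrid′ : ∀ {p} → p ∈ q ∷ A → InGrid m₁ m₂ p
  inGrid′ (here refl)  = q∈grid
  inGrid′ (there p∈A) = inGrid p∈A

  inc′ : PairwiseIncomparable (q ∷ A)
  inc′ (here refl)  (here refl)   q≢q = ⊥-elim (q≢q refl)
  inc′ (here refl)  (there p∈A)  _   = separated⇒incomparable (lookup sep p∈A)
  inc′ (there p∈A) (here refl)   _   = swap (separated⇒incomparable (lookup sep p∈A))
  inc′ (there p∈A) (there p′∈A) p≢p′ = inc p∈A p′∈A p≢p′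

separated-from-⊆ : ∀ {B} → PairwiseIncomparable B → (∀ {p} → p ∈ A → p ∈ B) → q ∈ B → q ∉ A →
  All (Separated q) A
separated-from-⊆ {q = q} inc A⊆B q∈B q∉A = tabulate λ p∈A →
  let q≢p : q ≢ _
      q≢p q≡p = q∉A (subst (_∈ _) (sym q≡p) p∈A)
  in incomparable⇒separated (inc q∈B (A⊆B p∈A) q≢p) q≢p

maximal⇔¬freeCell : IsAntichain m₁ m₂ A → IsMaximalAntichain m₁ m₂ A ⇔ (¬ FreeCell m₁ m₂ A)
maximal⇔¬freeCell {m₁} {m₂} {A} anti = mk⇔ maximal⇒¬freeCell ¬freeCell⇒maximal
  where
  maximal⇒¬freeCell : IsMaximalAntichain m₁ m₂ A → ¬ FreeCell m₁ m₂ A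
  maximal⇒¬freeCell (_ , maximal) (q , q∈grid , sep) =
    separated-irrefl (lookup sep (maximal (q ∷ A) (antichain-∷ anti q∈grid sep) there (here refl)))

  ¬freeCell⇒maximal : ¬ FreeCell m₁ m₂ A → IsMaximalAntichain m₁ m₂ A
  ¬freeCell⇒maximal noFreeCell = anti , maximal
    where
    maximal : ∀ B → IsAntichain m₁ m₂ B → (∀ {p} → p ∈ A → p ∈ B) → ∀ {q} → q ∈ B → q ∈ A
    maximal B (inGrid , inc) A⊆B {q} q∈B with q ∈? A
    ... | yes q∈A = q∈A
    ... | no  q∉A = ⊥-elim (noFreeCell (q , inGrid q∈B , separated-from-⊆ inc A⊆B q∈B q∉A))

vh⇔freeCell : IsAntichain m₁ m₂ A → ZIncreasing A → ContainsVH (hvdWord m₁ m₂ A) ⇔ FreeCell m₁ m₂ A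
vh⇔freeCell {m₁} {m₂} {A} (inGrid , inc) sorted = mk⇔ vh⇒freeCell freeCell⇒vh
  where
  vh⇒freeCell : ContainsVH (hvdWord m₁ m₂ A) → FreeCell m₁ m₂ A
  vh⇒freeCell vh
    with gap⇒freeCell (hasVH⇒gap m₁ 0 (suc m₂) A (containsVH⇒hasVH vh))
           (Linked⇒AllPairs ↙-trans (corner-↙-linked inGrid (zIncreasing⇒↙-linked inc sorted)))
           (tabulate inGrid) ≤-refl
  ... | q , q∈grid , _ , sep = q , q∈grid , sep

  freeCell⇒vh : FreeCell m₁ m₂ A → ContainsVH (hvdWord m₁ m₂ A)
  freeCell⇒vh (q , q∈grid@((1≤q₁ , _) , (_ , q₂≤m₂)) , sep) =
    hasVH⇒containsVH (gap⇒hasVH (freeCell⇒gap q∈grid (1≤q₁ , s≤s q₂≤m₂) sep))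

proposition9 : (m₁ m₂ : ℕ) → 1 ≤ m₁ → 1 ≤ m₂ → (A : List Point) →
    IsAntichain m₁ m₂ A → ZIncreasing A →
    (IsMaximalAntichain m₁ m₂ A ⇔ (¬ ContainsVH (hvdWord m₁ m₂ A)))
proposition9 _ _ _ _ _ anti sorted =
  ⇔-trans (maximal⇔¬freeCell anti) (¬-cong-⇔ (⇔-sym (vh⇔freeCell anti sorted)))
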